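{- For every integer $x\ge 2$, \[ \frac{x}{\max_{1\le n\le x}\tau(n)}\;\le\; a(x)\;\le\;\left\lceil \frac{x}{2}\right\rceil . \] In particular, for every $\varepsilon>0$ one has $a(x)\gg_\varepsilon x^{1-\varepsilon}$.
   Context: $\tau(n)$ denotes the number of positive divisors of $n$. For an integer $x\ge1$ the orbit is defined by $n_0=x$, $n_{j+1}=n_j-\tau(n_j)$, and $a(x):=\min\{k\ge 0: n_k\le 0\}$ is the orbit length. -}

module Defs where

open import Data.Nat using (ℕ; zero; suc; _⊔_)
open import Data.Nat.Divisibility using (_∣?_)
open import Data.List using (List; length; filter; map; upTo; foldr)
open import Data.Integer using (ℤ; +_; _-_; ∣_∣)

oneTo : ℕ → List ℕ
oneTo n = map suc (upTo n)

τ : ℕ → ℕ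
τ n = length (filter (_∣? n) (oneTo n))

maxτ : ℕ → ℕ
maxτ x = foldr _⊔_ 0 (map τ (oneTo x))

-- the orbit n_0 = x, n_{j+1} = n_j - τ(n_j), as integers.
-- (τ is applied to |n_j|; only the terms with n_j ≥ 1 are ever relevant.)
orbit : ℕ → ℕ → ℤ
orbit x zero = + x
orbit x (suc j) = orbit x j - + τ ∣ orbit x j ∣

-- k is the orbit length a(x) = min { k ≥ 0 : n_k ≤ 0 }
open import Data.Nat using (_<_)
open import Data.Integer using () renaming (_≤_ to _≤ℤ_; _<_ to _<ℤ_)
open import Data.Product using (_×_)

IsOrbitLength : ℕ → ℕ → Set
IsOrbitLength x k = (orbit x k ≤ℤ + 0) × (∀ j → j < k → + 0 <ℤ orbit x j)

-- Work with the orbit in ℕ, where n ↦ n ∸ τ n fixes 0. Every step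
-- of an orbit starting at x removes τ(n) ≤ max_{m ≤ x} τ(m), so reaching 0 takes
-- at least x / maxτ x steps. Conversely τ(1) = 1 and τ(n) ≥ 2 for n ≥ 2, so each
-- step removes at least 2 unless it reaches 0 from 1, which bounds the number
-- of steps by ⌈x/2⌉.
module Submission where

open import Defs
open import Data.Nat using (ℕ; _≤_; _*_; ⌈_/2⌉)
open import Data.Product using (Σ; _×_)

open import Data.Nat using (zero; suc; _+_; _∸_; _<_; z≤n; s≤s)
open import Data.Nat.Properties
open import Data.Nat.Divisibility using (_∣?_; ∣-refl; 1∣_)
open import Data.Nat.GeneralisedArithmetic using (fold; iterate; iterate-is-fold)
open import Data.Nat.Induction using (<-rec)
open import Data.List using (List; _∷_; length; filter; map; upTo; applyUpTo)
open import Data.List.Properties using (length-filter; length-map; length-upTo; filter-accept; foldr-forcesᵇ)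
open import Data.List.Membership.Propositional using (_∈_)
open import Data.List.Membership.Propositional.Properties using (∈-map⁺; ∈-upTo⁺; ∈-filter⁺)
open import Data.List.Relation.Unary.Any using (here; there)
import Data.List.Relation.Unary.All as All
open import Data.Product using (_,_)
open import Relation.Binary.PropositionalEquality using (_≡_; refl; cong; sym; trans; subst)
import Data.Integer as ℤ
import Data.Integer.Properties as ℤ

divisors : ℕ → List ℕ
divisors n = filter (_∣? n) (oneTo n)

∈-oneTo⁺ : ∀ {m n} → m < n → suc m ∈ oneTo n
∈-oneTo⁺ m<n = ∈-map⁺ suc (∈-upTo⁺ m<n)

n∈divisors : ∀ n → suc n ∈ divisors (suc n)
n∈divisors n = ∈-filter⁺ (_∣? suc n) (∈-oneTo⁺ ≤-refl) ∣-refl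

nonempty⇒length>0 : ∀ {a} {xs : List ℕ} → a ∈ xs → 0 < length xs
nonempty⇒length>0 (here _)  = s≤s z≤n
nonempty⇒length>0 (there _) = s≤s z≤n

τ≤n : ∀ n → τ n ≤ n
τ≤n n = begin
  length (divisors n)         ≤⟨ length-filter (_∣? n) (oneTo n) ⟩
  length (oneTo n)            ≡⟨ trans (length-map suc (upTo n)) (length-upTo n) ⟩
  n                           ∎
  where open ≤-Reasoning

τ>0 : ∀ n → 0 < τ (suc n)
τ>0 n = nonempty⇒length>0 (n∈divisors n)

-- The divisor list of n ≥ 2 is 1 followed by a list that still contains n.
τ≥2 : ∀ n → 2 ≤ τ (2 + n)
τ≥2 n = subst (λ ds → 2 ≤ length ds) (sym divisors≡1∷rest) (s≤s (nonempty⇒length>0 m∈rest))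
  where
  m : ℕ
  m = 2 + n
  rest : List ℕ
  rest = map suc (applyUpTo suc (suc n))
  divisors≡1∷rest : divisors m ≡ 1 ∷ filter (_∣? m) rest
  divisors≡1∷rest = filter-accept (_∣? m) (1∣ m)
  m∈rest : m ∈ filter (_∣? m) rest
  m∈rest with subst (m ∈_) divisors≡1∷rest (n∈divisors (suc n))
  ... | here ()
  ... | there m∈rest = m∈rest

τ≤maxτ : ∀ {n x} → n ≤ x → τ n ≤ maxτ x
τ≤maxτ {zero}  _   = z≤n
τ≤maxτ {suc n} {x} n<x = All.lookup τs≤maxτ (∈-map⁺ τ (∈-oneTo⁺ n<x))
  where
  τs≤maxτ : All.All (_≤ maxτ x) (map τ (oneTo x))
  τs≤maxτ = foldr-forcesᵇ (λ a b a⊔b≤ → m⊔n≤o⇒m≤o a b a⊔b≤ , m⊔n≤o⇒n≤o a b a⊔b≤)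
                          0 _ ≤-refl

orbitStep : ℕ → ℕ
orbitStep n = n ∸ τ n

orbitStep≤n∸2 : ∀ n → orbitStep n ≤ n ∸ 2
orbitStep≤n∸2 zero          = z≤n
orbitStep≤n∸2 (suc zero)    = ∸-monoʳ-≤ 1 (τ>0 0)
orbitStep≤n∸2 (suc (suc n)) = ∸-monoʳ-≤ (2 + n) (τ≥2 n)

orbitStep-< : ∀ n → orbitStep (suc n) < suc n
orbitStep-< n = s≤s (≤-trans (orbitStep≤n∸2 (suc n)) (m∸n≤m n 1))

⌈orbitStep/2⌉<⌈n/2⌉ : ∀ n → ⌈ orbitStep (suc n) /2⌉ < ⌈ suc n /2⌉
⌈orbitStep/2⌉<⌈n/2⌉ n = ≤-<-trans (⌈n/2⌉-mono (orbitStep≤n∸2 (suc n))) (⌈n∸1/2⌉<⌈n+1/2⌉ n)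
  where
  ⌈n∸1/2⌉<⌈n+1/2⌉ : ∀ n → ⌈ n ∸ 1 /2⌉ < ⌈ suc n /2⌉
  ⌈n∸1/2⌉<⌈n+1/2⌉ zero    = s≤s z≤n
  ⌈n∸1/2⌉<⌈n+1/2⌉ (suc n) = ≤-refl

orbitℕ : ℕ → ℕ → ℕ
orbitℕ n k = iterate orbitStep n k

IsOrbitLengthℕ : ℕ → ℕ → Set
IsOrbitLengthℕ n k = (orbitℕ n k ≡ 0) × (∀ j → j < k → 0 < orbitℕ n j)

orbitLength-≤⌈n/2⌉ : ∀ n → Σ ℕ (λ k → IsOrbitLengthℕ n k × k ≤ ⌈ n /2⌉)
orbitLength-≤⌈n/2⌉ = <-rec _ go
  where
  go : ∀ n → (∀ {m} → m < n → Σ ℕ (λ k → IsOrbitLengthℕ m k × k ≤ ⌈ m /2⌉)) →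
       Σ ℕ (λ k → IsOrbitLengthℕ n k × k ≤ ⌈ n /2⌉)
  go zero    _   = 0 , (refl , λ _ ()) , z≤n
  go (suc n) rec with rec (orbitStep-< n)
  ... | k , (hits0 , positive) , k≤ =
    suc k , (hits0 , positive′) , ≤-<-trans k≤ (⌈orbitStep/2⌉<⌈n/2⌉ n)
    where
    positive′ : ∀ j → j < suc k → 0 < orbitℕ (suc n) j
    positive′ zero    _         = s≤s z≤n
    positive′ (suc j) (s≤s j<k) = positive j j<k

n≤k*M+orbitℕ : ∀ {M} k n → (∀ {m} → m ≤ n → τ m ≤ M) → n ≤ k * M + orbitℕ n k
n≤k*M+orbitℕ {M} zero    n _    = ≤-refl
n≤k*M+orbitℕ {M} (suc k) n τ≤M = begin
  n                                    ≡⟨ sym (m+[n∸m]≡n (τ≤n n)) ⟩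
  τ n + orbitStep n                    ≤⟨ +-mono-≤ (τ≤M ≤-refl) ih ⟩
  M + (k * M + orbitℕ (orbitStep n) k) ≡⟨ sym (+-assoc M (k * M) _) ⟩
  suc k * M + orbitℕ n (suc k)         ∎
  where
  open ≤-Reasoning
  ih : orbitStep n ≤ k * M + orbitℕ (orbitStep n) k
  ih = n≤k*M+orbitℕ k (orbitStep n) (λ m≤ → τ≤M (≤-trans m≤ (m∸n≤m n (τ n))))

orbit≡+orbitℕ : ∀ x j → orbit x j ≡ ℤ.+ orbitℕ x j
orbit≡+orbitℕ x j = trans (orbit≡fold j) (cong ℤ.+_ (iterate-is-fold x orbitStep j))
  where
  orbit≡fold : ∀ j → orbit x j ≡ ℤ.+ fold x orbitStep j
  orbit≡fold zero    = refl
  orbit≡fold (suc j) rewrite orbit≡fold j =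
    let n = fold x orbitStep j in trans (ℤ.m-n≡m⊖n n (τ n)) (ℤ.⊖-≥ (τ≤n n))

IsOrbitLengthℕ⇒IsOrbitLength : ∀ {x k} → IsOrbitLengthℕ x k → IsOrbitLength x k
IsOrbitLengthℕ⇒IsOrbitLength {x} {k} (hits0 , positive) =
  subst (ℤ._≤ ℤ.+ 0) (sym (orbit≡+orbitℕ x k)) (ℤ.+≤+ (≤-reflexive hits0)) ,
  λ j j<k → subst (ℤ.+ 0 ℤ.<_) (sym (orbit≡+orbitℕ x j)) (ℤ.+<+ (positive j j<k))

mainTheorem1 : ∀ (x : ℕ) → 2 ≤ x →
    Σ ℕ (λ k → IsOrbitLength x k × (x ≤ maxτ x * k) × (k ≤ ⌈ x /2⌉))
mainTheorem1 x _ with orbitLength-≤⌈n/2⌉ x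
... | k , isLength@(hits0 , _) , k≤⌈x/2⌉ =
  k , IsOrbitLengthℕ⇒IsOrbitLength isLength , x≤maxτ*k , k≤⌈x/2⌉
  where
  x≤maxτ*k : x ≤ maxτ x * k
  x≤maxτ*k = begin
    x                       ≤⟨ n≤k*M+orbitℕ k x τ≤maxτ ⟩
    k * maxτ x + orbitℕ x k ≡⟨ cong (k * maxτ x +_) hits0 ⟩
    k * maxτ x + 0          ≡⟨ +-identityʳ (k * maxτ x) ⟩
    k * maxτ x              ≡⟨ *-comm k (maxτ x) ⟩
    maxτ x * k              ∎
    where open ≤-Reasoning
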